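{- Let $D_G$ be the derivation of the polynomial ring $\mathbb{Q}[x,y,z]$ determined by $D_G(x)=D_G(y)=D_G(z)=xyz$ (i.e. $D_G=xyz(\partial_x+\partial_y+\partial_z)$). Then for every integer $n\geqslant 0$, $$D_G^n(yz)=\sum_{\sigma\in\mathcal{Q}_{n+1}^{(1)}}x^{{\rm plat}(\sigma)}y^{{\rm des}(\sigma)}z^{{\rm asc}(\sigma)}.$$
   Context: A Stirling permutation of a multiset is a word using each element of the multiset with its multiplicity such that for each value $i$, all letters occurring between two occurrences of $i$ are at least $i$. For $m\geqslant1$, $\mathcal{Q}_m^{(1)}$ is the set of Stirling permutations of the multiset $\{1,2,2,3,3,\ldots,m,m\}$ (the letter $1$ once, each of $2,\ldots,m$ twice). For a word $\sigma=\sigma_1\cdots\sigma_L$ set $\sigma_0=\sigma_{L+1}=0$; then ${\rm asc}(\sigma)=\#\{i\in\{0,\ldots,L\}:\sigma_i<\sigma_{i+1}\}$, ${\rm des}(\sigma)=\#\{i\in\{0,\ldots,L\}:\sigma_i>\sigma_{i+1}\}$, ${\rm plat}(\sigma)=\#\{i\in\{0,\ldots,L\}:\sigma_i=\sigma_{i+1}\}$. -}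

module Defs where

open import Data.Nat as ℕ using (ℕ; zero; suc; _≡ᵇ_; _<ᵇ_; _≤ᵇ_)
open import Data.Integer using (+_)
open import Data.Rational as ℚ using (ℚ; 0ℚ; 1ℚ)
open import Data.Bool using (Bool; true; false; _∧_; if_then_else_)
open import Data.List using (List; []; _∷_; _++_; map; filter; concatMap; foldr; length; upTo)
open import Data.List.Base using (all)
open import Data.Product using (_×_; _,_)
open import Function using (_∘_)
open import Relation.Nullary.Decidable using (Dec)
open import Data.Bool.Properties using (T?)

-- Polynomials in ℚ[x,y,z] as formal finite sums of terms
-- (c , a , b , e)  meaning  c · x^a y^b z^e.
-- Two such lists represent the same polynomial iff all coefficients
-- (computed by `coeff`) agree.

Term : Set
Term = ℚ × ℕ × ℕ × ℕ

Poly : Set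
Poly = List Term

fromℕ : ℕ → ℚ
fromℕ n = + n ℚ./ 1

coeff : ℕ → ℕ → ℕ → Poly → ℚ
coeff a b e [] = 0ℚ
coeff a b e ((c , a' , b' , e') ∷ p) =
  (if (a ≡ᵇ a') ∧ (b ≡ᵇ b') ∧ (e ≡ᵇ e') then c else 0ℚ) ℚ.+ coeff a b e p

-- On c x^a y^b z^e it gives
--   a c x^a y^(b+1) z^(e+1) + b c x^(a+1) y^b z^(e+1) + e c x^(a+1) y^(b+1) z^e
-- (the terms with a zero factor a, b or e vanish, so the exponent
--  bookkeeping x·x^(a-1) = x^a is correct whenever the coefficient is nonzero).
DTerm : Term → Poly
DTerm (c , a , b , e) =
  (fromℕ a ℚ.* c , a , suc b , suc e) ∷
  (fromℕ b ℚ.* c , suc a , b , suc e) ∷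
  (fromℕ e ℚ.* c , suc a , suc b , e) ∷ []

DG : Poly → Poly
DG = concatMap DTerm

iterate : ℕ → (Poly → Poly) → Poly → Poly
iterate zero f p = p
iterate (suc n) f p = f (iterate n f p)

yz : Poly
yz = (1ℚ , 0 , 1 , 1) ∷ []

words : ℕ → ℕ → List (List ℕ)
words m zero = [] ∷ []
words m (suc L) = concatMap (λ w → map (λ k → suc k ∷ w) (upTo m)) (words m L)

count : ℕ → List ℕ → ℕ
count k [] = 0
count k (a ∷ w) = if k ≡ᵇ a then suc (count k w) else count k w

-- multiplicity of letter k in the multiset {1,2,2,3,3,…,m,m}
mult : ℕ → ℕ
mult 1 = 1
mult _ = 2

multisetOK : ℕ → List ℕ → Bool
multisetOK m w = all (λ k → count (suc k) w ≡ᵇ mult (suc k)) (upTo m)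

-- Stirling condition: for each pair of positions j < l with w_j = w_l = i,
-- every letter strictly between them is ≥ i.
stirlingFrom : ℕ → List ℕ → List ℕ → Bool
stirlingFrom i pre [] = true
stirlingFrom i pre (b ∷ bs) =
  (if b ≡ᵇ i then all (i ≤ᵇ_) pre else true) ∧ stirlingFrom i (pre ++ (b ∷ [])) bs

stirling : List ℕ → Bool
stirling [] = true
stirling (a ∷ w) = stirlingFrom a [] w ∧ stirling w

isQ1 : ℕ → List ℕ → Bool
isQ1 m w = multisetOK m w ∧ stirling w

-- Q_m^(1): Stirling permutations of {1,2,2,…,m,m} (words of length 2m-1)
Q1 : ℕ → List (List ℕ)
Q1 m = filter (λ w → T? (isQ1 m w)) (words m (ℕ.pred (2 ℕ.* m)))

pad : List ℕ → List ℕ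
pad w = 0 ∷ (w ++ (0 ∷ []))

countPairs : (ℕ → ℕ → Bool) → List ℕ → ℕ
countPairs r [] = 0
countPairs r (a ∷ []) = 0
countPairs r (a ∷ b ∷ w) = (if r a b then 1 else 0) ℕ.+ countPairs r (b ∷ w)

asc des plat : List ℕ → ℕ
asc w = countPairs _<ᵇ_ (pad w)
des w = countPairs (λ a b → b <ᵇ a) (pad w)
plat w = countPairs _≡ᵇ_ (pad w)

genPoly : ℕ → Poly
genPoly m = map (λ σ → (1ℚ , plat σ , des σ , asc σ)) (Q1 m)

-- A word σ ∈ Q(m+1) contains its largest letter k = m+1 as an adjacent pair kk (a letter between the two
-- copies would have to exceed k), so deleting kk is a bijection from Q(m+1) onto the pairs (τ, gap) with
-- τ ∈ Q(m) and a gap among the 2m adjacent pairs of the padded word 0τ0. Inserting kk into a plateau, descent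
-- or ascent (p, x) replaces it by the ascent (p, k), the plateau (k, k) and the descent (k, x), so it multiplies
-- x^plat y^des z^asc by yz, xz or xy respectively. Summed over all gaps of τ this gives
-- plat·x^plat y^(des+1) z^(asc+1) + des·x^(plat+1) y^des z^(asc+1) + asc·x^(plat+1) y^(des+1) z^asc,
-- which is D_G(x^plat y^des z^asc). Hence the generating polynomials satisfy P(m+1) = D_G P(m), and P(1) = yz.
module Submission where

open import Defs
open import Data.Nat using (ℕ; zero; suc; _+_; _≤_; _<_; z<s; s<s; _≡ᵇ_; _<ᵇ_; _≤ᵇ_; pred; _*_)
import Data.Nat.Properties as ℕ
open import Data.Integer using (+_)
open import Data.Rational as ℚ using (ℚ; 0ℚ; 1ℚ)
import Data.Rational.Properties as ℚ
open import Algebra.Bundles using (CommutativeMonoid)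
open import Algebra.Properties.CommutativeSemigroup (CommutativeMonoid.commutativeSemigroup ℚ.+-0-commutativeMonoid)
  using (x∙yz≈y∙xz)
open import Data.Rational.Unnormalised as ℚᵘ using (mkℚᵘ; *≡*)
import Data.Rational.Unnormalised.Properties as ℚᵘ
open import Data.Bool using (Bool; true; false; T; _∧_; if_then_else_)
open import Data.Bool.Properties using (T-∧; ∧-zeroʳ; T?)
open import Data.Unit using (⊤; tt)
open import Data.List using (List; []; _∷_; _++_; map; concatMap; foldr; length; upTo; cartesianProductWith; filter)
open import Data.List.Base using (all)
open import Data.List.Membership.Propositional using (_∈_; find; lose)
open import Data.List.Membership.Propositional.Properties.WithK using (unique∧set⇒bag)
open import Data.List.Relation.Binary.BagAndSetEquality using (∼bag⇒↭)
open import Data.List.Membership.Propositional.Properties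
  using (∈-cartesianProductWith⁺; ∈-cartesianProductWith⁻; ∈-upTo⁺; ∈-upTo⁻; ∈-filter⁺; ∈-filter⁻; ∈-++⁻; ∈-++⁺ˡ; ∈-++⁺ʳ; ∈-map⁺; ∈-map⁻; ∈-concatMap⁺; ∈-concatMap⁻)
open import Data.List.Relation.Unary.Any using (here; there)
open import Data.List.Relation.Unary.Unique.Propositional using (Unique)
open import Data.List.Relation.Unary.AllPairs using ([]; _∷_)
import Data.List.Relation.Unary.Unique.Propositional.Properties as Unique
import Data.List.Properties as List
open import Data.List.Relation.Unary.All as All using (All; []; _∷_)
import Data.List.Relation.Unary.All.Properties as All
open import Data.List.Relation.Binary.Permutation.Propositional as ↭ using (_↭_)
import Data.List.Relation.Binary.Permutation.Propositional.Properties as ↭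
open import Data.Rational.Solver renaming (module +-*-Solver to ℚ-Solver)
open import Data.Integer.Solver renaming (module +-*-Solver to ℤ-Solver)
open import Data.Nat.Tactic.RingSolver using (solve-∀)
open import Data.Maybe using (Maybe; just; nothing)
open import Data.Product using (_×_; _,_; proj₁; proj₂; ∃; ∃₂)
open import Data.Sum using (inj₁; inj₂)
open import Data.Empty using (⊥; ⊥-elim)
open import Relation.Nullary using (yes; no; ¬?)
open import Function using (_∘_; case_of_)
open import Function.Bundles using (Equivalence; _⇔_; mk⇔)
open import Level using (0ℓ)
open import Relation.Binary.Bundles using (Setoid)
open import Relation.Binary.Structures using (IsEquivalence)
import Relation.Binary.Reasoning.Setoid as SetoidReasoning
open import Relation.Binary.Definitions using (tri<; tri≈; tri>)
open import Relation.Binary.PropositionalEquality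
  using (_≡_; _≢_; refl; sym; trans; cong; cong₂; subst; module ≡-Reasoning)

-- Polynomials up to equality of coefficients

record _≈_ (p q : Poly) : Set where
  constructor coeffwise
  field coeff-≡ : ∀ a b c → coeff a b c p ≡ coeff a b c q
open _≈_

infix 4 _≈_

≈-isEquivalence : IsEquivalence _≈_
≈-isEquivalence = record
  { refl  = coeffwise λ _ _ _ → refl
  ; sym   = λ p≈q → coeffwise λ a b c → sym (coeff-≡ p≈q a b c)
  ; trans = λ p≈q q≈r → coeffwise λ a b c → trans (coeff-≡ p≈q a b c) (coeff-≡ q≈r a b c)
  }

≈-setoid : Setoid 0ℓ 0ℓ
≈-setoid = record { isEquivalence = ≈-isEquivalence }

open Setoid ≈-setoid using () renaming (refl to ≈-refl; sym to ≈-sym; trans to ≈-trans)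

termCoeff : ℕ → ℕ → ℕ → Term → ℚ
termCoeff a b c (d , a′ , b′ , c′) = if (a ≡ᵇ a′) ∧ (b ≡ᵇ b′) ∧ (c ≡ᵇ c′) then d else 0ℚ

termCoeff-0 : ∀ a b c e → termCoeff a b c (0ℚ , e) ≡ 0ℚ
termCoeff-0 a b c (a′ , b′ , c′) with (a ≡ᵇ a′) ∧ (b ≡ᵇ b′) ∧ (c ≡ᵇ c′)
... | true  = refl
... | false = refl

termCoeff-+ : ∀ a b c d d′ e → termCoeff a b c (d ℚ.+ d′ , e) ≡ termCoeff a b c (d , e) ℚ.+ termCoeff a b c (d′ , e)
termCoeff-+ a b c d d′ (a′ , b′ , c′) with (a ≡ᵇ a′) ∧ (b ≡ᵇ b′) ∧ (c ≡ᵇ c′)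
... | true  = refl
... | false = refl

coeff-++ : ∀ a b c p q → coeff a b c (p ++ q) ≡ coeff a b c p ℚ.+ coeff a b c q
coeff-++ a b c []      q = sym (ℚ.+-identityˡ (coeff a b c q))
coeff-++ a b c (t ∷ p) q = trans (cong (termCoeff a b c t ℚ.+_) (coeff-++ a b c p q))
  (sym (ℚ.+-assoc (termCoeff a b c t) (coeff a b c p) (coeff a b c q)))

∷-cong : ∀ t {p q} → p ≈ q → t ∷ p ≈ t ∷ q
∷-cong t p≈q = coeffwise λ a b c → cong (termCoeff a b c t ℚ.+_) (coeff-≡ p≈q a b c)

++-cong : ∀ {p p′ q q′} → p ≈ p′ → q ≈ q′ → p ++ q ≈ p′ ++ q′
++-cong {p} {p′} {q} {q′} p≈p′ q≈q′ = coeffwise λ a b c → begin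
  coeff a b c (p ++ q)                  ≡⟨ coeff-++ a b c p q ⟩
  coeff a b c p ℚ.+ coeff a b c q        ≡⟨ cong₂ ℚ._+_ (coeff-≡ p≈p′ a b c) (coeff-≡ q≈q′ a b c) ⟩
  coeff a b c p′ ℚ.+ coeff a b c q′      ≡⟨ coeff-++ a b c p′ q′ ⟨
  coeff a b c (p′ ++ q′)                ∎
  where open ≡-Reasoning

↭⇒≈ : ∀ {p q} → p ↭ q → p ≈ q
↭⇒≈ ↭.refl          = ≈-refl
↭⇒≈ (↭.prep t p↭q)  = ∷-cong t (↭⇒≈ p↭q)
↭⇒≈ (↭.swap {xs} {ys} s t p↭q) = coeffwise λ a b c →
  trans (x∙yz≈y∙xz (termCoeff a b c s) (termCoeff a b c t) (coeff a b c xs))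
        (coeff-≡ (∷-cong t (∷-cong s (↭⇒≈ p↭q))) a b c)
↭⇒≈ (↭.trans p↭q q↭r) = ≈-trans (↭⇒≈ p↭q) (↭⇒≈ q↭r)

concatMap-cong : ∀ {A : Set} {f g : A → Poly} {xs} → All (λ x → f x ≈ g x) xs → concatMap f xs ≈ concatMap g xs
concatMap-cong []             = ≈-refl
concatMap-cong (fx≈gx ∷ rest) = ++-cong fx≈gx (concatMap-cong rest)

-- The coefficients of D_G p in terms of those of p

Coeffs : Set
Coeffs = ℕ → ℕ → ℕ → ℚ

Exp : Set
Exp = ℕ × ℕ × ℕ

weighted : Maybe (ℚ × Exp) → Coeffs → ℚ
weighted nothing                f = 0ℚ
weighted (just (s , a , b , c)) f = s ℚ.* f a b c

-- x^a y^b z^c arises from x^a y^(b-1) z^(c-1) under xyz ∂x with weight a, etc.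
from∂x from∂y from∂z : ℕ → ℕ → ℕ → Maybe (ℚ × Exp)
from∂x a       (suc b) (suc c) = just (fromℕ a , a , b , c)
from∂x _       _       _       = nothing
from∂y (suc a) b       (suc c) = just (fromℕ b , a , b , c)
from∂y _       _       _       = nothing
from∂z (suc a) (suc b) c       = just (fromℕ c , a , b , c)
from∂z _       _       _       = nothing

DCoeffs : Coeffs → Coeffs
DCoeffs f a b c = weighted (from∂x a b c) f ℚ.+ (weighted (from∂y a b c) f ℚ.+ weighted (from∂z a b c) f)

weighted-+ : ∀ m (f g : Coeffs) → weighted m (λ a b c → f a b c ℚ.+ g a b c) ≡ weighted m f ℚ.+ weighted m g
weighted-+ nothing                f g = refl
weighted-+ (just (s , a , b , c)) f g = ℚ.*-distribˡ-+ s (f a b c) (g a b c)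

weighted-0 : ∀ m → weighted m (λ _ _ _ → 0ℚ) ≡ 0ℚ
weighted-0 nothing                = refl
weighted-0 (just (s , a , b , c)) = ℚ.*-zeroʳ s

weighted-cong : ∀ m {f g : Coeffs} → (∀ a b c → f a b c ≡ g a b c) → weighted m f ≡ weighted m g
weighted-cong nothing                f≗g = refl
weighted-cong (just (s , a , b , c)) f≗g = cong (s ℚ.*_) (f≗g a b c)

DCoeffs-+ : ∀ (f g : Coeffs) a b c →
  DCoeffs (λ x y z → f x y z ℚ.+ g x y z) a b c ≡ DCoeffs f a b c ℚ.+ DCoeffs g a b c
DCoeffs-+ f g a b c = trans
  (cong₂ ℚ._+_ (weighted-+ (from∂x a b c) f g)
               (cong₂ ℚ._+_ (weighted-+ (from∂y a b c) f g) (weighted-+ (from∂z a b c) f g)))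
  (interchange₃ (weighted (from∂x a b c) f) (weighted (from∂x a b c) g) (weighted (from∂y a b c) f)
                (weighted (from∂y a b c) g) (weighted (from∂z a b c) f) (weighted (from∂z a b c) g))
  where
  interchange₃ : ∀ x₁ y₁ x₂ y₂ x₃ y₃ →
    (x₁ ℚ.+ y₁) ℚ.+ ((x₂ ℚ.+ y₂) ℚ.+ (x₃ ℚ.+ y₃)) ≡ (x₁ ℚ.+ (x₂ ℚ.+ x₃)) ℚ.+ (y₁ ℚ.+ (y₂ ℚ.+ y₃))
  interchange₃ = solve 6 (λ x₁ y₁ x₂ y₂ x₃ y₃ →
    (x₁ :+ y₁) :+ ((x₂ :+ y₂) :+ (x₃ :+ y₃)) := (x₁ :+ (x₂ :+ x₃)) :+ (y₁ :+ (y₂ :+ y₃))) refl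
    where open ℚ-Solver

DCoeffs-0 : ∀ a b c → DCoeffs (λ _ _ _ → 0ℚ) a b c ≡ 0ℚ
DCoeffs-0 a b c = cong₂ ℚ._+_ (weighted-0 (from∂x a b c))
                              (cong₂ ℚ._+_ (weighted-0 (from∂y a b c)) (weighted-0 (from∂z a b c)))

DCoeffs-cong : ∀ {f g : Coeffs} → (∀ a b c → f a b c ≡ g a b c) → ∀ a b c → DCoeffs f a b c ≡ DCoeffs g a b c
DCoeffs-cong f≗g a b c = cong₂ ℚ._+_ (weighted-cong (from∂x a b c) f≗g)
  (cong₂ ℚ._+_ (weighted-cong (from∂y a b c) f≗g) (weighted-cong (from∂z a b c) f≗g))

if-false : ∀ {β} (d : ℚ) → β ≡ false → (if β then d else 0ℚ) ≡ 0ℚ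
if-false d refl = refl

if-scale : ∀ β {n n′} d → (T β → n ≡ n′) → (if β then fromℕ n′ ℚ.* d else 0ℚ) ≡ fromℕ n ℚ.* (if β then d else 0ℚ)
if-scale true  d n≡n′ = cong (λ k → fromℕ k ℚ.* d) (sym (n≡n′ _))
if-scale false {n} d _ = sym (ℚ.*-zeroʳ (fromℕ n))

∧∧-zeroʳ : ∀ x y → x ∧ y ∧ false ≡ false
∧∧-zeroʳ x y = trans (cong (x ∧_) (∧-zeroʳ y)) (∧-zeroʳ x)

T-∧₁ : ∀ {x y} → T (x ∧ y) → T x
T-∧₁ = proj₁ ∘ Equivalence.to T-∧

T-∧₂ : ∀ {x y} → T (x ∧ y) → T y
T-∧₂ = proj₂ ∘ Equivalence.to T-∧

termCoeff-xyz∂x : ∀ a b c d a′ b′ c′ → termCoeff a b c (fromℕ a′ ℚ.* d , a′ , suc b′ , suc c′)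
                ≡ weighted (from∂x a b c) (λ x y z → termCoeff x y z (d , a′ , b′ , c′))
termCoeff-xyz∂x a zero c d a′ b′ c′ = if-false _ (∧-zeroʳ (a ≡ᵇ a′))
termCoeff-xyz∂x a (suc b) zero d a′ b′ c′ = if-false _ (∧∧-zeroʳ (a ≡ᵇ a′) (b ≡ᵇ b′))
termCoeff-xyz∂x a (suc b) (suc c) d a′ b′ c′ =
  if-scale ((a ≡ᵇ a′) ∧ (b ≡ᵇ b′) ∧ (c ≡ᵇ c′)) d (ℕ.≡ᵇ⇒≡ a a′ ∘ T-∧₁ {a ≡ᵇ a′} {(b ≡ᵇ b′) ∧ (c ≡ᵇ c′)})

termCoeff-xyz∂y : ∀ a b c d a′ b′ c′ → termCoeff a b c (fromℕ b′ ℚ.* d , suc a′ , b′ , suc c′)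
                ≡ weighted (from∂y a b c) (λ x y z → termCoeff x y z (d , a′ , b′ , c′))
termCoeff-xyz∂y zero b c d a′ b′ c′ = refl
termCoeff-xyz∂y (suc a) b zero d a′ b′ c′ = if-false _ (∧∧-zeroʳ (a ≡ᵇ a′) (b ≡ᵇ b′))
termCoeff-xyz∂y (suc a) b (suc c) d a′ b′ c′ =
  if-scale ((a ≡ᵇ a′) ∧ (b ≡ᵇ b′) ∧ (c ≡ᵇ c′)) d (ℕ.≡ᵇ⇒≡ b b′ ∘ T-∧₁ {b ≡ᵇ b′} {c ≡ᵇ c′} ∘ T-∧₂ {a ≡ᵇ a′})

termCoeff-xyz∂z : ∀ a b c d a′ b′ c′ → termCoeff a b c (fromℕ c′ ℚ.* d , suc a′ , suc b′ , c′)
                ≡ weighted (from∂z a b c) (λ x y z → termCoeff x y z (d , a′ , b′ , c′))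
termCoeff-xyz∂z zero b c d a′ b′ c′ = refl
termCoeff-xyz∂z (suc a) zero c d a′ b′ c′ = if-false _ (∧-zeroʳ (a ≡ᵇ a′))
termCoeff-xyz∂z (suc a) (suc b) c d a′ b′ c′ =
  if-scale ((a ≡ᵇ a′) ∧ (b ≡ᵇ b′) ∧ (c ≡ᵇ c′)) d (ℕ.≡ᵇ⇒≡ c c′ ∘ T-∧₂ {b ≡ᵇ b′} {c ≡ᵇ c′} ∘ T-∧₂ {a ≡ᵇ a′})

coeff-DTerm : ∀ t a b c → coeff a b c (DTerm t) ≡ DCoeffs (λ x y z → termCoeff x y z t) a b c
coeff-DTerm (d , a′ , b′ , c′) a b c = cong₂ ℚ._+_ (termCoeff-xyz∂x a b c d a′ b′ c′)
  (cong₂ ℚ._+_ (termCoeff-xyz∂y a b c d a′ b′ c′)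
               (trans (ℚ.+-identityʳ _) (termCoeff-xyz∂z a b c d a′ b′ c′)))

coeff-DG : ∀ p a b c → coeff a b c (DG p) ≡ DCoeffs (λ x y z → coeff x y z p) a b c
coeff-DG []      a b c = sym (DCoeffs-0 a b c)
coeff-DG (t ∷ p) a b c = begin
  coeff a b c (DTerm t ++ DG p)                          ≡⟨ coeff-++ a b c (DTerm t) (DG p) ⟩
  coeff a b c (DTerm t) ℚ.+ coeff a b c (DG p)           ≡⟨ cong₂ ℚ._+_ (coeff-DTerm t a b c) (coeff-DG p a b c) ⟩
  DCoeffs (λ x y z → termCoeff x y z t) a b c ℚ.+ DCoeffs (λ x y z → coeff x y z p) a b c
                                                         ≡⟨ DCoeffs-+ _ _ a b c ⟨
  DCoeffs (λ x y z → coeff x y z (t ∷ p)) a b c          ∎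
  where open ≡-Reasoning

DG-cong : ∀ {p q} → p ≈ q → DG p ≈ DG q
DG-cong {p} {q} p≈q = coeffwise λ a b c →
  trans (coeff-DG p a b c) (trans (DCoeffs-cong (coeff-≡ p≈q) a b c) (sym (coeff-DG q a b c)))

infixl 6 _⊕_

_⊕_ : Exp → Exp → Exp
(a , b , c) ⊕ (a′ , b′ , c′) = a + a′ , b + b′ , c + c′

⊕-assoc : ∀ e f g → (e ⊕ f) ⊕ g ≡ e ⊕ (f ⊕ g)
⊕-assoc (a , b , c) (a′ , b′ , c′) (a″ , b″ , c″) =
  cong₂ _,_ (ℕ.+-assoc a a′ a″) (cong₂ _,_ (ℕ.+-assoc b b′ b″) (ℕ.+-assoc c c′ c″))

⊕-exchange : ∀ o s κ e → o ⊕ (s ⊕ κ ⊕ e) ≡ s ⊕ (o ⊕ (κ ⊕ e))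
⊕-exchange (a , b , c) (a′ , b′ , c′) (a″ , b″ , c″) (a‴ , b‴ , c‴) =
  cong₂ _,_ (exchange a a′ a″ a‴) (cong₂ _,_ (exchange b b′ b″ b‴) (exchange c c′ c″ c‴))
  where
  exchange : ∀ o s κ e → o + (s + κ + e) ≡ s + (o + (κ + e))
  exchange = solve-∀

fromℕ-+ : ∀ m n → fromℕ (m + n) ≡ fromℕ m ℚ.+ fromℕ n
fromℕ-+ m n = ℚ.toℚᵘ-injective (begin
    ℚ.toℚᵘ (fromℕ (m + n))                 ≈⟨ toℚᵘ-fromℕ (m + n) ⟩
    mkℚᵘ (+ (m + n)) 0                     ≈⟨ *≡* (solve 2 (λ m n → (m :+ n) :* con (+ 1) :=
                                                     (m :* con (+ 1) :+ n :* con (+ 1)) :* con (+ 1)) refl (+ m) (+ n)) ⟩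
    mkℚᵘ (+ m) 0 ℚᵘ.+ mkℚᵘ (+ n) 0          ≈⟨ ℚᵘ.+-cong (ℚᵘ.≃-sym (toℚᵘ-fromℕ m)) (ℚᵘ.≃-sym (toℚᵘ-fromℕ n)) ⟩
    ℚ.toℚᵘ (fromℕ m) ℚᵘ.+ ℚ.toℚᵘ (fromℕ n)  ≈⟨ ℚᵘ.≃-sym (ℚ.toℚᵘ-homo-+ (fromℕ m) (fromℕ n)) ⟩
    ℚ.toℚᵘ (fromℕ m ℚ.+ fromℕ n)            ∎)
  where
  open ℚᵘ.≃-Reasoning
  open ℤ-Solver
  toℚᵘ-fromℕ : ∀ n → ℚ.toℚᵘ (fromℕ n) ℚᵘ.≃ mkℚᵘ (+ n) 0
  toℚᵘ-fromℕ n = ℚ.toℚᵘ-fromℚᵘ (mkℚᵘ (+ n) 0)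

-- D_G x^e = derivTerms e e; the first argument carries the three weights separately.
derivTerms : Exp → Exp → Poly
derivTerms (n₁ , n₂ , n₃) e =
  (fromℕ n₁ , (0 , 1 , 1) ⊕ e) ∷ (fromℕ n₂ , (1 , 0 , 1) ⊕ e) ∷ (fromℕ n₃ , (1 , 1 , 0) ⊕ e) ∷ []

DTerm-monomial : ∀ e → DTerm (1ℚ , e) ≡ derivTerms e e
DTerm-monomial (a , b , c)
  rewrite ℚ.*-identityʳ (fromℕ a) | ℚ.*-identityʳ (fromℕ b) | ℚ.*-identityʳ (fromℕ c) = refl

derivTerms-⊕ : ∀ m n e → derivTerms (m ⊕ n) e ≈ derivTerms m e ++ derivTerms n e
derivTerms-⊕ m@(m₁ , m₂ , m₃) n@(n₁ , n₂ , n₃) e = coeffwise λ a b c →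
  let t : ℕ → Exp → ℚ
      t i f = termCoeff a b c (fromℕ i , f)
      split : ∀ i j f → t (i + j) f ≡ t i f ℚ.+ t j f
      split i j f = trans (cong (λ d → termCoeff a b c (d , f)) (fromℕ-+ i j)) (termCoeff-+ a b c _ _ f)
      e₁ = (0 , 1 , 1) ⊕ e ; e₂ = (1 , 0 , 1) ⊕ e ; e₃ = (1 , 1 , 0) ⊕ e
  in begin
  coeff a b c (derivTerms (m ⊕ n) e)
    ≡⟨ cong₂ ℚ._+_ (split m₁ n₁ e₁) (cong₂ ℚ._+_ (split m₂ n₂ e₂) (cong (ℚ._+ 0ℚ) (split m₃ n₃ e₃))) ⟩
  (t m₁ e₁ ℚ.+ t n₁ e₁) ℚ.+ ((t m₂ e₂ ℚ.+ t n₂ e₂) ℚ.+ ((t m₃ e₃ ℚ.+ t n₃ e₃) ℚ.+ 0ℚ))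
    ≡⟨ interchange₃ (t m₁ e₁) (t n₁ e₁) (t m₂ e₂) (t n₂ e₂) (t m₃ e₃) (t n₃ e₃) ⟩
  coeff a b c (derivTerms m e) ℚ.+ coeff a b c (derivTerms n e)
    ≡⟨ coeff-++ a b c (derivTerms m e) (derivTerms n e) ⟨
  coeff a b c (derivTerms m e ++ derivTerms n e) ∎
  where
  open ≡-Reasoning
  interchange₃ : ∀ x₁ y₁ x₂ y₂ x₃ y₃ →
    (x₁ ℚ.+ y₁) ℚ.+ ((x₂ ℚ.+ y₂) ℚ.+ ((x₃ ℚ.+ y₃) ℚ.+ 0ℚ)) ≡ (x₁ ℚ.+ (x₂ ℚ.+ (x₃ ℚ.+ 0ℚ))) ℚ.+ (y₁ ℚ.+ (y₂ ℚ.+ (y₃ ℚ.+ 0ℚ)))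
  interchange₃ = solve 6 (λ x₁ y₁ x₂ y₂ x₃ y₃ →
    (x₁ :+ y₁) :+ ((x₂ :+ y₂) :+ ((x₃ :+ y₃) :+ con 0ℚ)) :=
    (x₁ :+ (x₂ :+ (x₃ :+ con 0ℚ))) :+ (y₁ :+ (y₂ :+ (y₃ :+ con 0ℚ)))) refl
    where open ℚ-Solver

-- the exponent that one plateau, descent or ascent contributes to x^plat y^des z^asc
data Kind : Exp → Set where
  plateau : Kind (1 , 0 , 0)
  descent : Kind (0 , 1 , 0)
  ascent  : Kind (0 , 0 , 1)

-- inserting kk into a pair of kind κ changes the exponent by (1,1,1) − κ
complement : ∀ {κ} → Kind κ → Exp
complement plateau = 0 , 1 , 1
complement descent = 1 , 0 , 1
complement ascent  = 1 , 1 , 0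

complement-⊕ : ∀ {κ} (k : Kind κ) → complement k ⊕ κ ≡ (1 , 1 , 1)
complement-⊕ plateau = refl
complement-⊕ descent = refl
complement-⊕ ascent  = refl

derivTerms-unit : ∀ {κ} (k : Kind κ) e → derivTerms κ e ≈ (1ℚ , complement k ⊕ e) ∷ []
derivTerms-unit plateau e = coeffwise λ a b c →
  cong (termCoeff a b c (1ℚ , (0 , 1 , 1) ⊕ e) ℚ.+_)
       (cong₂ ℚ._+_ (termCoeff-0 a b c _) (cong (ℚ._+ 0ℚ) (termCoeff-0 a b c _)))
derivTerms-unit descent e = coeffwise λ a b c →
  trans (cong₂ ℚ._+_ (termCoeff-0 a b c _) (cong (termCoeff a b c (1ℚ , (1 , 0 , 1) ⊕ e) ℚ.+_)
                                                 (cong (ℚ._+ 0ℚ) (termCoeff-0 a b c _))))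
        (ℚ.+-identityˡ _)
derivTerms-unit ascent e = coeffwise λ a b c →
  trans (cong₂ ℚ._+_ (termCoeff-0 a b c _) (cong₂ ℚ._+_ (termCoeff-0 a b c _) refl))
        (trans (ℚ.+-identityˡ _) (ℚ.+-identityˡ _))

-- Statistics as sums over the adjacent pairs of the padded word

indicator : Bool → ℕ
indicator b = if b then 1 else 0

pairKind : ℕ × ℕ → Exp
pairKind (p , x) = indicator (p ≡ᵇ x) , indicator (x <ᵇ p) , indicator (p <ᵇ x)

pairKind-< : ∀ {p k} → p < k → pairKind (p , k) ≡ (0 , 0 , 1)
pairKind-< z<s       = refl
pairKind-< {suc p} {suc k} (s<s p<k) = pairKind-< {p} {k} p<k

pairKind-> : ∀ {x k} → x < k → pairKind (k , x) ≡ (0 , 1 , 0)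
pairKind-> z<s       = refl
pairKind-> {suc x} {suc k} (s<s x<k) = pairKind-> {x} {k} x<k

pairKind-≡ : ∀ k → pairKind (k , k) ≡ (1 , 0 , 0)
pairKind-≡ zero    = refl
pairKind-≡ (suc k) = pairKind-≡ k

kindOf : ∀ p x → Kind (pairKind (p , x))
kindOf p x with ℕ.<-cmp p x
... | tri< p<x _ _    = subst Kind (sym (pairKind-< p<x)) ascent
... | tri≈ _ refl _   = subst Kind (sym (pairKind-≡ p)) plateau
... | tri> _ _ x<p    = subst Kind (sym (pairKind-> x<p)) descent

adjacentPairs : ℕ → List ℕ → List (ℕ × ℕ)
adjacentPairs p []      = (p , 0) ∷ []
adjacentPairs p (x ∷ σ) = (p , x) ∷ adjacentPairs x σ

pairsExp : List (ℕ × ℕ) → Exp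
pairsExp = foldr (λ g e → pairKind g ⊕ e) (0 , 0 , 0)

statTerm : List ℕ → Term
statTerm σ = 1ℚ , plat σ , des σ , asc σ

statTerm-pairs : ∀ σ → statTerm σ ≡ (1ℚ , pairsExp (adjacentPairs 0 σ))
statTerm-pairs σ = cong (1ℚ ,_) (counts-pairs 0 σ)
  where
  counts-pairs : ∀ p σ → let w = p ∷ σ ++ 0 ∷ [] in
    (countPairs _≡ᵇ_ w , countPairs (λ a b → b <ᵇ a) w , countPairs _<ᵇ_ w) ≡ pairsExp (adjacentPairs p σ)
  counts-pairs p []      = refl
  counts-pairs p (x ∷ σ) = cong (pairKind (p , x) ⊕_) (counts-pairs x σ)

insertions : ℕ → List ℕ → List (List ℕ)
insertions k []      = (k ∷ k ∷ []) ∷ []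
insertions k (x ∷ σ) = (k ∷ k ∷ x ∷ σ) ∷ map (x ∷_) (insertions k σ)

splitPairs : ℕ → List (ℕ × ℕ) → List (List (ℕ × ℕ))
splitPairs k []             = []
splitPairs k ((p , x) ∷ gs) = ((p , k) ∷ (k , k) ∷ (k , x) ∷ gs) ∷ map ((p , x) ∷_) (splitPairs k gs)

adjacentPairs-insertions : ∀ k p σ → map (adjacentPairs p) (insertions k σ) ≡ splitPairs k (adjacentPairs p σ)
adjacentPairs-insertions k p []      = refl
adjacentPairs-insertions k p (x ∷ σ) = cong (((p , k) ∷ (k , k) ∷ (k , x) ∷ adjacentPairs x σ) ∷_) (begin
  map (adjacentPairs p) (map (x ∷_) (insertions k σ))   ≡⟨ List.map-∘ (insertions k σ) ⟨
  map (((p , x) ∷_) ∘ adjacentPairs x) (insertions k σ) ≡⟨ List.map-∘ (insertions k σ) ⟩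
  map ((p , x) ∷_) (map (adjacentPairs x) (insertions k σ)) ≡⟨ cong (map _) (adjacentPairs-insertions k x σ) ⟩
  map ((p , x) ∷_) (splitPairs k (adjacentPairs x σ))   ∎)
  where open ≡-Reasoning

Below : ℕ → ℕ × ℕ → Set
Below k (p , x) = p < k × x < k

adjacentPairs-below : ∀ {k p σ} → p < k → 0 < k → All (_< k) σ → All (Below k) (adjacentPairs p σ)
adjacentPairs-below p<k 0<k []           = (p<k , 0<k) ∷ []
adjacentPairs-below p<k 0<k (x<k ∷ σ<k) = (p<k , x<k) ∷ adjacentPairs-below x<k 0<k σ<k

splitPairs-exp : ∀ {p x k} → p < k → x < k → ∀ e →
  pairKind (p , k) ⊕ (pairKind (k , k) ⊕ (pairKind (k , x) ⊕ e)) ≡ (1 , 1 , 1) ⊕ e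
splitPairs-exp {k = k} p<k x<k e =
  cong₂ _⊕_ (pairKind-< p<k) (cong₂ _⊕_ (pairKind-≡ k) (cong (_⊕ e) (pairKind-> x<k)))

derivTerms-zero : ∀ e → derivTerms (0 , 0 , 0) e ≈ []
derivTerms-zero e = coeffwise λ a b c →
  cong₂ ℚ._+_ (termCoeff-0 a b c _) (cong₂ ℚ._+_ (termCoeff-0 a b c _) (cong (ℚ._+ 0ℚ) (termCoeff-0 a b c _)))

-- o is the exponent already contributed by the pairs to the left of gs.
splitPairs-sum : ∀ {k} gs → All (Below k) gs → ∀ o →
  map (λ hs → 1ℚ , o ⊕ pairsExp hs) (splitPairs k gs) ≈ derivTerms (pairsExp gs) (o ⊕ pairsExp gs)
splitPairs-sum []             []                   o = ≈-sym (derivTerms-zero (o ⊕ (0 , 0 , 0)))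
splitPairs-sum {k} ((p , x) ∷ gs) ((p<k , x<k) ∷ gs<k) o = begin
  (1ℚ , o ⊕ (pairKind (p , k) ⊕ (pairKind (k , k) ⊕ (pairKind (k , x) ⊕ E)))) ∷
    map (λ hs → 1ℚ , o ⊕ pairsExp hs) (map ((p , x) ∷_) (splitPairs k gs))
    ≡⟨ cong₂ _∷_ (cong (λ e → 1ℚ , o ⊕ e) (splitPairs-exp p<k x<k E))
                 (trans (sym (List.map-∘ (splitPairs k gs)))
                        (List.map-cong (λ hs → cong (1ℚ ,_) (sym (⊕-assoc o κ (pairsExp hs)))) (splitPairs k gs))) ⟩
  (1ℚ , o ⊕ ((1 , 1 , 1) ⊕ E)) ∷ map (λ hs → 1ℚ , o ⊕ κ ⊕ pairsExp hs) (splitPairs k gs)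
    ≈⟨ ∷-cong _ (splitPairs-sum gs gs<k (o ⊕ κ)) ⟩
  (1ℚ , o ⊕ ((1 , 1 , 1) ⊕ E)) ∷ derivTerms E (o ⊕ κ ⊕ E)
    ≡⟨ cong₂ (λ u v → (1ℚ , u) ∷ derivTerms E v) exponent (⊕-assoc o κ E) ⟩
  (1ℚ , complement K ⊕ F) ∷ derivTerms E F
    ≈⟨ ++-cong (derivTerms-unit K F) ≈-refl ⟨
  derivTerms κ F ++ derivTerms E F
    ≈⟨ derivTerms-⊕ κ E F ⟨
  derivTerms (κ ⊕ E) F ∎
  where
  open SetoidReasoning ≈-setoid
  κ = pairKind (p , x)
  K = kindOf p x
  E = pairsExp gs
  F = o ⊕ (κ ⊕ E)
  exponent : o ⊕ ((1 , 1 , 1) ⊕ E) ≡ complement K ⊕ F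
  exponent = trans (cong (λ u → o ⊕ (u ⊕ E)) (sym (complement-⊕ K))) (⊕-exchange o (complement K) κ E)

insertions-statTerm : ∀ {k} σ → 0 < k → All (_< k) σ → map statTerm (insertions k σ) ≈ DTerm (statTerm σ)
insertions-statTerm {k} σ 0<k σ<k = begin
  map statTerm (insertions k σ)
    ≡⟨ List.map-cong statTerm-pairs (insertions k σ) ⟩
  map (λ w → 1ℚ , pairsExp (adjacentPairs 0 w)) (insertions k σ)
    ≡⟨ List.map-∘ (insertions k σ) ⟩
  map (λ hs → 1ℚ , pairsExp hs) (map (adjacentPairs 0) (insertions k σ))
    ≡⟨ cong (map _) (adjacentPairs-insertions k 0 σ) ⟩
  map (λ hs → 1ℚ , pairsExp hs) (splitPairs k (adjacentPairs 0 σ))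
    ≈⟨ splitPairs-sum (adjacentPairs 0 σ) (adjacentPairs-below 0<k 0<k σ<k) (0 , 0 , 0) ⟩
  derivTerms E E
    ≡⟨ DTerm-monomial E ⟨
  DTerm (1ℚ , E)
    ≡⟨ cong DTerm (statTerm-pairs σ) ⟨
  DTerm (statTerm σ) ∎
  where
  open SetoidReasoning ≈-setoid
  E = pairsExp (adjacentPairs 0 σ)

insertions-DG : ∀ {k} L → 0 < k → All (All (_< k)) L →
  map statTerm (concatMap (insertions k) L) ≈ DG (map statTerm L)
insertions-DG {k} L 0<k L<k = begin
  map statTerm (concatMap (insertions k) L)   ≡⟨ List.map-concatMap statTerm (insertions k) L ⟩
  concatMap (map statTerm ∘ insertions k) L   ≈⟨ concatMap-cong (All.map (insertions-statTerm _ 0<k) L<k) ⟩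
  concatMap (DTerm ∘ statTerm) L              ≡⟨ List.concatMap-map DTerm statTerm L ⟨
  DG (map statTerm L)                         ∎
  where open SetoidReasoning ≈-setoid

-- Words and the boolean conditions of Q1, propositionally

≡ᵇ-refl : ∀ n → (n ≡ᵇ n) ≡ true
≡ᵇ-refl zero    = refl
≡ᵇ-refl (suc n) = ≡ᵇ-refl n

Letter : ℕ → ℕ → Set
Letter m x = 0 < x × x ≤ m

words-suc : ∀ m L → words m (suc L) ≡ cartesianProductWith (λ w k → suc k ∷ w) (words m L) (upTo m)
words-suc m L = concatMap-product (words m L)
  where
  concatMap-product : ∀ ws →
    concatMap (λ w → map (λ k → suc k ∷ w) (upTo m)) ws ≡ cartesianProductWith (λ w k → suc k ∷ w) ws (upTo m)
  concatMap-product []       = refl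
  concatMap-product (w ∷ ws) = cong (map (λ k → suc k ∷ w) (upTo m) ++_) (concatMap-product ws)

∈-words⁻ : ∀ m L {w} → w ∈ words m L → length w ≡ L × All (Letter m) w
∈-words⁻ m zero    (here refl) = refl , []
∈-words⁻ m (suc L) w∈
  with w , k , w∈ws , k∈ , refl ← ∈-cartesianProductWith⁻ _ (words m L) (upTo m) (subst (_ ∈_) (words-suc m L) w∈)
  = let length≡ , letters = ∈-words⁻ m L w∈ws in cong suc length≡ , (z<s , ∈-upTo⁻ k∈) ∷ letters

∈-words⁺ : ∀ m {w} → All (Letter m) w → w ∈ words m (length w)
∈-words⁺ m []                         = here refl
∈-words⁺ m {_ ∷ w} ((z<s , k<m) ∷ letters) = subst (_ ∈_) (sym (words-suc m (length w)))
  (∈-cartesianProductWith⁺ (λ w k → suc k ∷ w) (∈-words⁺ m letters) (∈-upTo⁺ k<m))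

words-unique : ∀ m L → Unique (words m L)
words-unique m zero    = [] ∷ []
words-unique m (suc L) = subst Unique (sym (words-suc m L))
  (Unique.cartesianProductWith⁺ (λ w k → suc k ∷ w) (λ { refl → refl , refl }) (words-unique m L) (Unique.upTo⁺ m))

Multiplicities : ℕ → List ℕ → Set
Multiplicities m w = ∀ j → j < m → count (suc j) w ≡ mult (suc j)

multisetOK⇔ : ∀ m w → T (multisetOK m w) ⇔ Multiplicities m w
multisetOK⇔ m w = mk⇔
  (λ ok j j<m → ℕ.≡ᵇ⇒≡ _ _ (All.lookup (All.all⁺ _ (upTo m) ok) (∈-upTo⁺ j<m)))
  (λ mult≡ → All.all⁻ _ (All.tabulate λ {j} j∈ → ℕ.≡⇒≡ᵇ _ _ (mult≡ j (∈-upTo⁻ j∈))))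

AboveUntilLast : ℕ → List ℕ → Set
AboveUntilLast a []      = ⊤
AboveUntilLast a (b ∷ w) = (a ∈ w → a ≤ b) × AboveUntilLast a w

Stirling : List ℕ → Set
Stirling []      = ⊤
Stirling (a ∷ w) = AboveUntilLast a w × Stirling w

stirlingFrom⇒ : ∀ a pre w → T (stirlingFrom a pre w) → (a ∈ w → All (a ≤_) pre) × AboveUntilLast a w
stirlingFrom⇒ a pre []      _  = (λ ()) , tt
stirlingFrom⇒ a pre (b ∷ w) ok
  with here-ok , rest-ok ← Equivalence.to T-∧ ok
  with later , above ← stirlingFrom⇒ a (pre ++ b ∷ []) w rest-ok
  = a∈ , (λ a∈w → All.head (All.++⁻ʳ pre (later a∈w))) , above
  where
  a∈ : a ∈ b ∷ w → All (a ≤_) pre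
  a∈ (here refl) = All.map (ℕ.≤ᵇ⇒≤ a _)
    (All.all⁺ _ pre (subst (λ β → T (if β then all (a ≤ᵇ_) pre else true)) (≡ᵇ-refl a) here-ok))
  a∈ (there a∈w) = All.++⁻ˡ pre (later a∈w)

stirlingFrom⇐ : ∀ a pre w → (a ∈ w → All (a ≤_) pre) → AboveUntilLast a w → T (stirlingFrom a pre w)
stirlingFrom⇐ a pre []      _     _             = tt
stirlingFrom⇐ a pre (b ∷ w) pre≥a (a≤b , above) = Equivalence.from T-∧ (here-ok ,
  stirlingFrom⇐ a (pre ++ b ∷ []) w (λ a∈w → All.++⁺ (pre≥a (there a∈w)) (a≤b a∈w ∷ [])) above)
  where
  here-ok : T (if b ≡ᵇ a then all (a ≤ᵇ_) pre else true)
  here-ok with b ≡ᵇ a in b≡ᵇa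
  ... | true  = All.all⁻ _ (All.map ℕ.≤⇒≤ᵇ (pre≥a (here (sym (ℕ.≡ᵇ⇒≡ b a (subst T (sym b≡ᵇa) tt))))))
  ... | false = tt

stirling⇔ : ∀ w → T (stirling w) ⇔ Stirling w
stirling⇔ w = mk⇔ (to w) (from w)
  where
  to : ∀ w → T (stirling w) → Stirling w
  to []      _  = tt
  to (a ∷ w) ok = let head-ok , tail-ok = Equivalence.to T-∧ ok in
    proj₂ (stirlingFrom⇒ a [] w head-ok) , to w tail-ok
  from : ∀ w → Stirling w → T (stirling w)
  from []      _                 = tt
  from (a ∷ w) (above , st) = Equivalence.from T-∧ (stirlingFrom⇐ a [] w (λ _ → []) above , from w st)

record StirlingPerm (m : ℕ) (w : List ℕ) : Set where
  field
    length≡        : length w ≡ pred (2 * m)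
    letters        : All (Letter m) w
    multiplicities : Multiplicities m w
    isStirling     : Stirling w

∈-Q1⁻ : ∀ {m w} → w ∈ Q1 m → StirlingPerm m w
∈-Q1⁻ {m} {w} w∈ =
  let w∈words , ok = ∈-filter⁻ (λ w → T? (isQ1 m w)) w∈
      length≡ , letters = ∈-words⁻ m _ w∈words
      multiset-ok , stirling-ok = Equivalence.to T-∧ ok
  in record { length≡ = length≡ ; letters = letters
            ; multiplicities = Equivalence.to (multisetOK⇔ m w) multiset-ok
            ; isStirling = Equivalence.to (stirling⇔ w) stirling-ok }

∈-Q1⁺ : ∀ {m w} → StirlingPerm m w → w ∈ Q1 m
∈-Q1⁺ {m} {w} perm = ∈-filter⁺ (λ w → T? (isQ1 m w))
  (subst (λ L → w ∈ words m L) length≡ (∈-words⁺ m letters))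
  (Equivalence.from T-∧ (Equivalence.from (multisetOK⇔ m w) multiplicities , Equivalence.from (stirling⇔ w) isStirling))
  where open StirlingPerm perm

Q1-unique : ∀ m → Unique (Q1 m)
Q1-unique m = Unique.filter⁺ (λ w → T? (isQ1 m w)) (words-unique m (pred (2 * m)))

count-++ : ∀ j u v → count j (u ++ v) ≡ count j u + count j v
count-++ j []      v = refl
count-++ j (x ∷ u) v with j ≡ᵇ x
... | true  = cong suc (count-++ j u v)
... | false = count-++ j u v

≡ᵇ-≢ : ∀ {m n} → m ≢ n → (m ≡ᵇ n) ≡ false
≡ᵇ-≢ {zero}  {zero}  m≢n = ⊥-elim (m≢n refl)
≡ᵇ-≢ {zero}  {suc n} _   = refl
≡ᵇ-≢ {suc m} {zero}  _   = refl
≡ᵇ-≢ {suc m} {suc n} m≢n = ≡ᵇ-≢ (m≢n ∘ cong suc)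

count-other : ∀ {j x} w → j ≢ x → count j (x ∷ w) ≡ count j w
count-other {j} {x} w j≢x rewrite ≡ᵇ-≢ j≢x = refl

count-self : ∀ k w → count k (k ∷ w) ≡ suc (count k w)
count-self k w rewrite ≡ᵇ-refl k = refl

count-absent : ∀ {k w} → All (_≢ k) w → count k w ≡ 0
count-absent []             = refl
count-absent {w = _ ∷ w} (x≢k ∷ w≢k) = trans (count-other w (x≢k ∘ sym)) (count-absent w≢k)

count≡0⇒absent : ∀ k w → count k w ≡ 0 → All (_≢ k) w
count≡0⇒absent k []      _    = []
count≡0⇒absent k (x ∷ w) none with k ≡ᵇ x in k≡ᵇx
count≡0⇒absent k (x ∷ w) ()   | true
count≡0⇒absent k (x ∷ w) none | false =
  (λ { refl → case trans (sym k≡ᵇx) (≡ᵇ-refl k) of λ () }) ∷ count≡0⇒absent k w none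

count>0⇒∈ : ∀ k w → 0 < count k w → k ∈ w
count>0⇒∈ k (x ∷ w) some with k ≡ᵇ x in k≡ᵇx
... | true  = here (ℕ.≡ᵇ⇒≡ k x (subst T (sym k≡ᵇx) tt))
... | false = there (count>0⇒∈ k w some)

count-insert-other : ∀ {j k : ℕ} (u v : List ℕ) → j ≢ k → count j (u ++ k ∷ k ∷ v) ≡ count j (u ++ v)
count-insert-other {j} {k} u v j≢k = begin
  count j (u ++ _ ∷ _ ∷ v)         ≡⟨ count-++ j u _ ⟩
  count j u + count j (_ ∷ _ ∷ v)  ≡⟨ cong (_+_ (count j u)) (trans (count-other (k ∷ v) j≢k) (count-other v j≢k)) ⟩
  count j u + count j v            ≡⟨ count-++ j u v ⟨
  count j (u ++ v)                 ∎
  where open ≡-Reasoning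

count-insert-self : ∀ k u v → count k (u ++ k ∷ k ∷ v) ≡ 2 + count k (u ++ v)
count-insert-self k u v = begin
  count k (u ++ k ∷ k ∷ v)          ≡⟨ count-++ k u _ ⟩
  count k u + count k (k ∷ k ∷ v)   ≡⟨ cong (_+_ (count k u)) (trans (count-self k (k ∷ v)) (cong suc (count-self k v))) ⟩
  count k u + (2 + count k v)       ≡⟨ ℕ.+-comm (count k u) _ ⟩
  2 + count k v + count k u         ≡⟨ ℕ.+-assoc 2 (count k v) (count k u) ⟩
  2 + (count k v + count k u)       ≡⟨ cong (_+_ 2) (trans (ℕ.+-comm (count k v) _) (sym (count-++ k u v))) ⟩
  2 + count k (u ++ v)              ∎
  where open ≡-Reasoning

∈-insert : ∀ {a k : ℕ} (u v : List ℕ) → a ∈ u ++ v → a ∈ u ++ k ∷ v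
∈-insert {k = k} u v a∈ with ∈-++⁻ u {v} a∈
... | inj₁ a∈u = ∈-++⁺ˡ {ys = k ∷ v} a∈u
... | inj₂ a∈v = ∈-++⁺ʳ u (there a∈v)

∈-delete : ∀ {a k : ℕ} (u v : List ℕ) → a ≢ k → a ∈ u ++ k ∷ v → a ∈ u ++ v
∈-delete {k = k} u v a≢k a∈ with ∈-++⁻ u {k ∷ v} a∈
... | inj₁ a∈u         = ∈-++⁺ˡ {ys = v} a∈u
... | inj₂ (here a≡k)  = ⊥-elim (a≢k a≡k)
... | inj₂ (there a∈v) = ∈-++⁺ʳ u a∈v

AboveUntilLast-below : ∀ {a} w → All (_< a) w → AboveUntilLast a w
AboveUntilLast-below []      []          = tt
AboveUntilLast-below (b ∷ w) (_ ∷ w<a) =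
  (λ a∈w → ⊥-elim (ℕ.<-irrefl refl (All.lookup w<a a∈w))) , AboveUntilLast-below w w<a

AboveUntilLast-insert : ∀ {a k : ℕ} (u v : List ℕ) → a < k → AboveUntilLast a (u ++ v) → AboveUntilLast a (u ++ k ∷ k ∷ v)
AboveUntilLast-insert []      v a<k above         = (λ _ → ℕ.<⇒≤ a<k) , (λ _ → ℕ.<⇒≤ a<k) , above
AboveUntilLast-insert (b ∷ u) v a<k (a≤b , above) =
  a≤b ∘ ∈-delete u v a≢k ∘ ∈-delete u (_ ∷ v) a≢k , AboveUntilLast-insert u v a<k above
  where a≢k = ℕ.<⇒≢ a<k

AboveUntilLast-delete : ∀ {a k : ℕ} (u v : List ℕ) → AboveUntilLast a (u ++ k ∷ v) → AboveUntilLast a (u ++ v)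
AboveUntilLast-delete []      v (_ , above)   = above
AboveUntilLast-delete (b ∷ u) v (a≤b , above) = a≤b ∘ ∈-insert u v , AboveUntilLast-delete u v above

Stirling-insert : ∀ {k : ℕ} (u v : List ℕ) → All (_< k) (u ++ v) → Stirling (u ++ v) → Stirling (u ++ k ∷ k ∷ v)
Stirling-insert [] v v<k st = ((λ _ → ℕ.≤-refl) , AboveUntilLast-below v v<k) , AboveUntilLast-below v v<k , st
Stirling-insert (a ∷ u) v (a<k ∷ w<k) (above , st) =
  AboveUntilLast-insert u v a<k above , Stirling-insert u v w<k st

Stirling-delete : ∀ {k : ℕ} (u v : List ℕ) → Stirling (u ++ k ∷ v) → Stirling (u ++ v)
Stirling-delete []      v (_ , st)     = st
Stirling-delete (a ∷ u) v (above , st) = AboveUntilLast-delete u v above , Stirling-delete u v st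

Stirling-suffix : ∀ (u : List ℕ) {w} → Stirling (u ++ w) → Stirling w
Stirling-suffix []      st       = st
Stirling-suffix (_ ∷ u) (_ , st) = Stirling-suffix u st

largest-repeats-at-once : ∀ {k} v → AboveUntilLast k v → All (_≤ k) v → k ∈ v → ∃ λ v′ → v ≡ k ∷ v′
largest-repeats-at-once {k} (b ∷ v) (k≤b , _) (b≤k ∷ _) k∈ with b ℕ.≟ k | k∈
... | yes refl | _           = v , refl
... | no b≢k   | here k≡b    = ⊥-elim (b≢k (sym k≡b))
... | no b≢k   | there k∈v   = ⊥-elim (b≢k (ℕ.≤-antisym b≤k (k≤b k∈v)))

first-occurrence : ∀ {k} w → k ∈ w → ∃₂ λ u v → w ≡ u ++ k ∷ v × All (_≢ k) u
first-occurrence {k} (x ∷ w) k∈ with x ℕ.≟ k | k∈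
... | yes refl | _         = [] , w , refl , []
... | no x≢k   | here k≡x  = ⊥-elim (x≢k (sym k≡x))
... | no x≢k   | there k∈w =
  let u , v , w≡ , u≢k = first-occurrence w k∈w in x ∷ u , v , cong (x ∷_) w≡ , x≢k ∷ u≢k

-- Q1 (n + 2) from Q1 (n + 1) by inserting kk

unique-concatMap : ∀ {A B : Set} (f : A → List B) (g : B → A) {xs} → Unique xs →
  All (λ x → Unique (f x) × All (λ y → g y ≡ x) (f x)) xs → Unique (concatMap f xs)
unique-concatMap f g []           []                        = []
unique-concatMap f g {x ∷ xs} (x∉xs ∷ xs!) ((fx! , g≡x) ∷ fibres) =
  Unique.++⁺ fx! (unique-concatMap f g xs! fibres) disjoint
  where
  disjoint : ∀ {y} → y ∈ f x × y ∈ concatMap f xs → ⊥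
  disjoint (y∈fx , y∈rest) with x′ , x′∈xs , y∈fx′ ← find (∈-concatMap⁻ f y∈rest) =
    All.lookup x∉xs x′∈xs (trans (sym (All.lookup g≡x y∈fx))
      (All.lookup (proj₂ (All.lookup fibres x′∈xs)) y∈fx′))

∈-insertions⁻ : ∀ {k w} σ → w ∈ insertions k σ → ∃₂ λ u v → σ ≡ u ++ v × w ≡ u ++ k ∷ k ∷ v
∈-insertions⁻ []      (here refl) = [] , [] , refl , refl
∈-insertions⁻ (x ∷ σ) (here refl) = [] , x ∷ σ , refl , refl
∈-insertions⁻ (x ∷ σ) (there w∈)
  with w , w∈σ , refl ← ∈-map⁻ (x ∷_) w∈
  with u , v , refl , refl ← ∈-insertions⁻ σ w∈σ
  = x ∷ u , v , refl , refl

∈-insertions⁺ : ∀ {k} u v → u ++ k ∷ k ∷ v ∈ insertions k (u ++ v)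
∈-insertions⁺ []      []      = here refl
∈-insertions⁺ []      (x ∷ v) = here refl
∈-insertions⁺ (x ∷ u) v       = there (∈-map⁺ (x ∷_) (∈-insertions⁺ u v))

insertions-unique : ∀ {k} σ → All (_≢ k) σ → Unique (insertions k σ)
insertions-unique []      []          = [] ∷ []
insertions-unique {k} (x ∷ σ) (x≢k ∷ σ≢k) =
  All.tabulate (λ w∈ → head≢ (∈-map⁻ (x ∷_) w∈)) ∷ Unique.map⁺ List.∷-injectiveʳ (insertions-unique σ σ≢k)
  where
  head≢ : ∀ {w} → ∃ (λ w′ → w′ ∈ insertions k σ × w ≡ x ∷ w′) → k ∷ k ∷ x ∷ σ ≢ w
  head≢ (_ , _ , refl) refl = x≢k refl

removeAll : ℕ → List ℕ → List ℕ
removeAll k = filter (λ x → ¬? (x ℕ.≟ k))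

removeAll-insertions : ∀ {k w} σ → All (_≢ k) σ → w ∈ insertions k σ → removeAll k w ≡ σ
removeAll-insertions {k} σ σ≢k w∈ with u , v , refl , refl ← ∈-insertions⁻ σ w∈ = begin
  removeAll k (u ++ k ∷ k ∷ v)                  ≡⟨ List.filter-++ _ u (k ∷ k ∷ v) ⟩
  removeAll k u ++ removeAll k (k ∷ k ∷ v)      ≡⟨ cong (removeAll k u ++_) drop-kk ⟩
  removeAll k u ++ removeAll k v                ≡⟨ List.filter-++ _ u v ⟨
  removeAll k (u ++ v)                          ≡⟨ List.filter-all _ σ≢k ⟩
  u ++ v                                        ∎
  where
  open ≡-Reasoning
  drop-kk : removeAll k (k ∷ k ∷ v) ≡ removeAll k v
  drop-kk = trans (List.filter-reject (λ x → ¬? (x ℕ.≟ k)) {xs = k ∷ v} (λ k≢k → k≢k refl))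
                  (List.filter-reject (λ x → ¬? (x ℕ.≟ k)) {xs = v} (λ k≢k → k≢k refl))

length-insert : ∀ {k : ℕ} (u v : List ℕ) → length (u ++ k ∷ k ∷ v) ≡ 2 + length (u ++ v)
length-insert []      v = refl
length-insert (x ∷ u) v = cong suc (length-insert u v)

All-insert : ∀ {P : ℕ → Set} {k} (u v : List ℕ) → P k → All P (u ++ v) → All P (u ++ k ∷ k ∷ v)
All-insert u v pk puv = let pu , pv = All.++⁻ u puv in All.++⁺ pu (pk ∷ pk ∷ pv)

All-delete : ∀ {P : ℕ → Set} {k} (u v : List ℕ) → All P (u ++ k ∷ k ∷ v) → All P (u ++ v)
All-delete u v pw with pu , _ ∷ _ ∷ pv ← All.++⁻ u pw = All.++⁺ pu pv

length-Q1-suc : ∀ n → pred (2 * suc (suc n)) ≡ 2 + pred (2 * suc n)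
length-Q1-suc n = cong suc (ℕ.+-suc n (suc n + 0))

StirlingPerm-insert : ∀ {n} (u v : List ℕ) → StirlingPerm (suc n) (u ++ v) →
  StirlingPerm (suc (suc n)) (u ++ suc (suc n) ∷ suc (suc n) ∷ v)
StirlingPerm-insert {n} u v perm = record
  { length≡        = trans (length-insert u v) (trans (cong (_+_ 2) length≡) (sym (length-Q1-suc n)))
  ; letters        = All-insert u v (z<s , ℕ.≤-refl) (All.map (λ (0<x , x≤) → 0<x , ℕ.m≤n⇒m≤1+n x≤) letters)
  ; multiplicities = multiplicities′
  ; isStirling     = Stirling-insert u v below isStirling
  }
  where
  open StirlingPerm perm
  below : All (_< suc (suc n)) (u ++ v)
  below = All.map (λ (_ , x≤) → s<s x≤) letters
  multiplicities′ : Multiplicities (suc (suc n)) (u ++ suc (suc n) ∷ suc (suc n) ∷ v)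
  multiplicities′ j j< with j ℕ.≟ suc n
  ... | yes refl = trans (count-insert-self _ u v) (cong (_+_ 2) (count-absent (All.map ℕ.<⇒≢ below)))
  ... | no j≢    = trans (count-insert-other u v (j≢ ∘ ℕ.suc-injective))
                         (multiplicities j (ℕ.≤∧≢⇒< (ℕ.≤-pred j<) j≢))

StirlingPerm-delete : ∀ {n} (u v : List ℕ) → All (_≢ suc (suc n)) (u ++ v) →
  StirlingPerm (suc (suc n)) (u ++ suc (suc n) ∷ suc (suc n) ∷ v) → StirlingPerm (suc n) (u ++ v)
StirlingPerm-delete {n} u v uv≢k perm = record
  { length≡        = ℕ.suc-injective (ℕ.suc-injective (trans (sym (length-insert u v)) (trans length≡ (length-Q1-suc n))))
  ; letters        = All.zipWith (λ ((0<x , x≤) , x≢) → 0<x , ℕ.≤-pred (ℕ.≤∧≢⇒< x≤ x≢)) (All-delete u v letters , uv≢k)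
  ; multiplicities = λ j j< → trans (sym (count-insert-other u v (ℕ.<⇒≢ j< ∘ ℕ.suc-injective)))
                                    (multiplicities j (ℕ.m<n⇒m<1+n j<))
  ; isStirling     = Stirling-delete u v (Stirling-delete u (_ ∷ v) isStirling)
  }
  where open StirlingPerm perm

count-after-first : ∀ {k} (u v : List ℕ) → All (_≢ k) u → count k (u ++ k ∷ v) ≡ suc (count k v)
count-after-first {k} u v u≢k = trans (count-++ k u (k ∷ v)) (trans (cong (_+ _) (count-absent u≢k)) (count-self k v))

largest-doubled : ∀ {n w} → StirlingPerm (suc (suc n)) w →
  ∃₂ λ u v → w ≡ u ++ suc (suc n) ∷ suc (suc n) ∷ v × All (_≢ suc (suc n)) (u ++ v)
largest-doubled {n} {w} perm
  with twice ← StirlingPerm.multiplicities perm (suc n) (ℕ.n<1+n (suc n))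
  with u , v′ , refl , u≢k ← first-occurrence w (count>0⇒∈ (suc (suc n)) w (subst (0 <_) (sym twice) z<s))
  with once ← ℕ.suc-injective (trans (sym (count-after-first u v′ u≢k)) twice)
  with v , refl ← largest-repeats-at-once v′ (proj₁ (Stirling-suffix u (StirlingPerm.isStirling perm)))
                    (All.map proj₂ (All.tail (All.++⁻ʳ u (StirlingPerm.letters perm))))
                    (count>0⇒∈ (suc (suc n)) v′ (subst (0 <_) (sym once) z<s))
  = u , v , refl ,
    All.++⁺ u≢k (count≡0⇒absent (suc (suc n)) v (ℕ.suc-injective (trans (sym (count-self (suc (suc n)) v)) once)))

Q1-below : ∀ n → All (All (_< suc (suc n))) (Q1 (suc n))
Q1-below n = All.tabulate λ σ∈ → All.map (λ (_ , x≤) → s<s x≤) (StirlingPerm.letters (∈-Q1⁻ σ∈))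

Q1-suc : ∀ n → Q1 (suc (suc n)) ↭ concatMap (insertions (suc (suc n))) (Q1 (suc n))
Q1-suc n = ∼bag⇒↭ (unique∧set⇒bag (Q1-unique (suc (suc n)))
  (unique-concatMap (insertions k) (removeAll k) (Q1-unique (suc n)) fibres) (mk⇔ to from))
  where
  k = suc (suc n)
  fibres : All (λ σ → Unique (insertions k σ) × All (λ w → removeAll k w ≡ σ) (insertions k σ)) (Q1 (suc n))
  fibres = All.map (λ σ<k → let σ≢k = All.map ℕ.<⇒≢ σ<k in
                      insertions-unique _ σ≢k , All.tabulate (removeAll-insertions _ σ≢k))
                   (Q1-below n)
  to : ∀ {w} → w ∈ Q1 k → w ∈ concatMap (insertions k) (Q1 (suc n))
  to w∈ with u , v , refl , uv≢k ← largest-doubled {n} (∈-Q1⁻ w∈) =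
    ∈-concatMap⁺ (insertions k) (lose (∈-Q1⁺ (StirlingPerm-delete u v uv≢k (∈-Q1⁻ w∈))) (∈-insertions⁺ u v))
  from : ∀ {w} → w ∈ concatMap (insertions k) (Q1 (suc n)) → w ∈ Q1 k
  from w∈ with σ , σ∈ , w∈σ ← find (∈-concatMap⁻ (insertions k) w∈)
          with u , v , refl , refl ← ∈-insertions⁻ σ w∈σ
    = ∈-Q1⁺ (StirlingPerm-insert u v (∈-Q1⁻ σ∈))

genPoly-suc : ∀ n → genPoly (suc (suc n)) ≈ DG (genPoly (suc n))
genPoly-suc n = begin
  map statTerm (Q1 (suc (suc n)))                                  ≈⟨ ↭⇒≈ (↭.map⁺ statTerm (Q1-suc n)) ⟩
  map statTerm (concatMap (insertions (suc (suc n))) (Q1 (suc n))) ≈⟨ insertions-DG (Q1 (suc n)) z<s (Q1-below n) ⟩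
  DG (map statTerm (Q1 (suc n)))                                   ∎
  where open SetoidReasoning ≈-setoid

iterate-DG-yz : ∀ n → iterate n DG yz ≈ genPoly (suc n)
iterate-DG-yz zero    = ≈-refl  -- Q1 1 evaluates to the single word 1, so genPoly 1 is yz
iterate-DG-yz (suc n) = ≈-trans (DG-cong (iterate-DG-yz n)) (≈-sym (genPoly-suc n))

lemma3p5 : (n a b c : ℕ) →
    coeff a b c (iterate n DG yz) ≡ coeff a b c (genPoly (suc n))
lemma3p5 n = coeff-≡ (iterate-DG-yz n)
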